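{- For every integer $m\ge1$, $$\beta(m;t,q)=L_m\bigl(1-q-tq,\,-tq^2\bigr).$$
   Context: Let $t,q$ be indeterminates and $m\ge1$ an integer. For $0\le d\le m-1$ let $\rho(m;t,d)=\frac{m}{m-d}\sum_{i=0}^{d}\binom{m-1-d+i}{i}\binom{m-1-i}{d-i}t^i$ (equivalently $\sum_{i=0}^{d}\frac{m(m-d)}{(m-i)(m-d+i)}\binom{m-d+i}{i}\binom{m-i}{d-i}t^i$), and let $\rho(m;t,m)=1+t^m$. Define $\beta(m;t,q)=\sum_{d=0}^{m}\rho(m;t,d)(-q)^d$. The Lucas polynomials are $L_0(x,s)=2$ and, for $m\ge1$, $L_m(x,s)=\sum_{i=0}^{\lfloor m/2\rfloor}\binom{m-i}{i}\frac{m}{m-i}s^ix^{m-2i}$. -}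

module Defs where

open import Data.Nat as ℕ using (ℕ; zero; suc; _∸_; _≡ᵇ_)
open import Data.Nat.DivMod using (_/_)
open import Data.Nat.Combinatorics using (_C_)
open import Data.Integer using (+_)
open import Data.Bool using (if_then_else_)
open import Data.Rational as ℚ using (ℚ; 0ℚ; 1ℚ; _+_; _*_; -_)

nat : ℕ → ℚ
nat n = + n ℚ./ 1

-- a / b as a rational; only ever used with b ≥ 1 (b = 0 gives 0, never used)
frac : ℕ → ℕ → ℚ
frac a zero    = 0ℚ
frac a (suc b) = + a ℚ./ suc b

pow : ℚ → ℕ → ℚ
pow x zero    = 1ℚ
pow x (suc n) = x * pow x n

sumTo : ℕ → (ℕ → ℚ) → ℚ
sumTo zero    f = f 0
sumTo (suc n) f = sumTo n f + f (suc n)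

rho : ℕ → ℚ → ℕ → ℚ
rho m t d =
  if d ≡ᵇ m
  then 1ℚ + pow t m
  else frac m (m ∸ d) *
       sumTo d (λ i → nat ((((m ∸ 1 ∸ d) ℕ.+ i) C i) ℕ.* ((m ∸ 1 ∸ i) C (d ∸ i))) * pow t i)

beta : ℕ → ℚ → ℚ → ℚ
beta m t q = sumTo m (λ d → rho m t d * pow (- q) d)

lucas : ℕ → ℚ → ℚ → ℚ
lucas zero    x s = nat 2
lucas (suc k) x s =
  sumTo (suc k / 2)
    (λ i → nat ((suc k ∸ i) C i) * frac (suc k) (suc k ∸ i) * pow s i * pow x (suc k ∸ 2 ℕ.* i))

{-# OPTIONS --safe #-}
-- Put u = -tq and v = -q, so that 1 - q - tq = 1 + u + v and -tq² = -uv, and let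
-- G_N = Σ_{i,j} C(N-j,i) C(N-i,j) uⁱ vʲ. Pascal's rule in both binomial factors gives
-- G_{N+2} = (1+u+v) G_{N+1} - uv G_N, so G_N is the Fibonacci polynomial
-- F_N(x,s) = Σ_k C(N-k,k) sᵏ x^(N-2k) at x = 1+u+v, s = -uv (same recurrence, same G₀ and G₁).
-- Both sides of the theorem are F_m + s F_{m-2}: the Lucas side because
-- m/(m-k) C(m-k,k) = C(m-k,k) + C(m-k-1,k-1), the β side because, for d = i+j < m,
-- m/(m-d) C(m-1-j,i) C(m-1-i,j) = C(m-j,i) C(m-i,j) - C(m-1-j,i-1) C(m-1-i,j-1),
-- which makes β_m = G_m - uv G_{m-2} coefficient by coefficient.
module Submission where

open import Defs
open import Data.Nat as ℕ using (ℕ; zero; suc; _∸_; _≤_; _<_; _≥_; _≡ᵇ_; z≤n; s≤s)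
import Data.Nat.Properties as ℕP
open import Data.Nat.DivMod using (_/_; m*n/n≡m; m/n≤m; /-monoˡ-≤)
open import Data.Nat.Combinatorics using (_C_; nCn≡1; nC1≡n; nCk≡nC[n∸k]; nCk+nC[k+1]≡[n+1]C[k+1]; k>n⇒nCk≡0)
open import Data.Nat.Tactic.RingSolver using () renaming (ring to ℕ-ring)
open import Tactic.RingSolver using (solve-∀)
open import Relation.Nullary using (Dec; yes; no)
open import Data.Bool using (true; false)
open import Data.Bool.Properties using (if-cong)
open import Relation.Nullary.Decidable using (dec⇒maybe)
import Data.Integer as ℤ
import Data.Integer.Properties as ℤP
open import Data.Integer.Tactic.RingSolver using () renaming (ring to ℤ-ring)
open import Data.Rational using (ℚ; 0ℚ; 1ℚ; toℚᵘ)
import Data.Rational.Properties as ℚP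
open import Data.Rational.Properties using (toℚᵘ-injective; toℚᵘ-fromℚᵘ; toℚᵘ-homo-+; toℚᵘ-homo-*)
open import Data.Rational.Unnormalised as ℚᵘ using (mkℚᵘ)
import Data.Rational.Unnormalised.Properties as ℚᵘP
open import Tactic.RingSolver.Core.AlmostCommutativeRing using (AlmostCommutativeRing; fromCommutativeRing)
open import Level using (0ℓ)
open import Relation.Binary.PropositionalEquality using (_≡_; refl; sym; trans; cong; cong₂; subst; module ≡-Reasoning)

module Coefficients where
  open import Data.Nat using (_+_; _*_)
  open ≡-Reasoning

  [1+k]*[1+n]C[1+k]≡[1+n]*nCk : ∀ n k → suc k * (suc n C suc k) ≡ suc n * (n C k)
  [1+k]*[1+n]C[1+k]≡[1+n]*nCk zero    zero    = refl
  [1+k]*[1+n]C[1+k]≡[1+n]*nCk zero    (suc k)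
    rewrite k>n⇒nCk≡0 {1} {2 + k} (s≤s (s≤s z≤n)) | k>n⇒nCk≡0 {0} {suc k} (s≤s z≤n) = ℕP.*-zeroʳ (2 + k)
  [1+k]*[1+n]C[1+k]≡[1+n]*nCk (suc n) zero
    rewrite nC1≡n (2 + n) = trans (ℕP.+-identityʳ _) (sym (ℕP.*-identityʳ _))
  [1+k]*[1+n]C[1+k]≡[1+n]*nCk (suc n) (suc k) = begin
    (2 + k) * ((2 + n) C (2 + k))                 ≡⟨ cong ((2 + k) *_) (sym (nCk+nC[k+1]≡[n+1]C[k+1] (suc n) (suc k))) ⟩
    (2 + k) * (A + B)                             ≡⟨ split k A B ⟩
    (suc k * A + A) + (2 + k) * B                 ≡⟨ cong₂ (λ x y → x + A + y) ([1+k]*[1+n]C[1+k]≡[1+n]*nCk n k) ([1+k]*[1+n]C[1+k]≡[1+n]*nCk n (suc k)) ⟩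
    (suc n * (n C k) + A) + suc n * (n C suc k)   ≡⟨ merge n (n C k) (n C suc k) A ⟩
    suc n * (n C k + n C suc k) + A               ≡⟨ cong (λ x → suc n * x + A) (nCk+nC[k+1]≡[n+1]C[k+1] n k) ⟩
    suc n * A + A                                 ≡⟨ collect n A ⟩
    (2 + n) * A ∎
    where
    A = suc n C suc k
    B = suc n C (2 + k)
    split : ∀ k A B → (2 + k) * (A + B) ≡ (suc k * A + A) + (2 + k) * B
    split = solve-∀ ℕ-ring
    merge : ∀ n x y A → (suc n * x + A) + suc n * y ≡ suc n * (x + y) + A
    merge = solve-∀ ℕ-ring
    collect : ∀ n A → suc n * A + A ≡ (2 + n) * A
    collect = solve-∀ ℕ-ring

  paths : ℕ → ℕ → ℕ
  paths a k = (a + k) C a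

  paths-sym : ∀ a k → paths a k ≡ (a + k) C k
  paths-sym a k = trans (nCk≡nC[n∸k] (ℕP.m≤m+n a k)) (cong ((a + k) C_) (ℕP.m+n∸m≡n a k))

  [1+k]*paths[a,1+k]≡[1+a+k]*paths[a,k] : ∀ a k → suc k * paths a (suc k) ≡ suc (a + k) * paths a k
  [1+k]*paths[a,1+k]≡[1+a+k]*paths[a,k] a k = begin
    suc k * paths a (suc k)         ≡⟨ cong (suc k *_) (paths-sym a (suc k)) ⟩
    suc k * ((a + suc k) C suc k)   ≡⟨ cong (λ n → suc k * (n C suc k)) (ℕP.+-suc a k) ⟩
    suc k * (suc (a + k) C suc k)   ≡⟨ [1+k]*[1+n]C[1+k]≡[1+n]*nCk (a + k) k ⟩
    suc (a + k) * ((a + k) C k)     ≡⟨ cong (suc (a + k) *_) (paths-sym a k) ⟨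
    suc (a + k) * paths a k         ∎

  [1+k]*paths[a,1+k]≡[1+a]*paths[1+a,k] : ∀ a k → suc k * paths a (suc k) ≡ suc a * paths (suc a) k
  [1+k]*paths[a,1+k]≡[1+a]*paths[1+a,k] a k =
    trans ([1+k]*paths[a,1+k]≡[1+a+k]*paths[a,k] a k) (sym ([1+k]*[1+n]C[1+k]≡[1+n]*nCk (a + k) a))

  shiftˡ shiftʳ : (ℕ → ℕ → ℕ) → ℕ → ℕ → ℕ
  shiftˡ c zero    j = 0
  shiftˡ c (suc i) j = c i j
  shiftʳ c i zero    = 0
  shiftʳ c i (suc j) = c i j

  paths² : ℕ → ℕ → ℕ → ℕ
  paths² k i j = paths i k * paths j k

  -- For i, j ≥ 1: multiply by 1+k and rewrite every paths _ (1+k) through the two absorption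
  -- identities; both sides become multiples of paths (1+i) k * paths (1+j) k, and the claim
  -- reduces to (k+1)(i+j+k+3) + (i+1)(j+1) = (i+k+2)(j+k+2).
  paths²-rec : ∀ i j k → (i + j + suc k) * paths² k i j + suc k * shiftˡ (shiftʳ (paths² (suc k))) i j
                         ≡ suc k * paths² (suc k) i j
  paths²-rec zero j k = begin
    (j + suc k) * (1 * paths j k) + suc k * 0   ≡⟨ tidy j k (paths j k) ⟩
    suc (j + k) * paths j k                     ≡⟨ [1+k]*paths[a,1+k]≡[1+a+k]*paths[a,k] j k ⟨
    suc k * paths j (suc k)                     ≡⟨ cong (suc k *_) (ℕP.*-identityˡ _) ⟨
    suc k * (1 * paths j (suc k))               ∎
    where
    tidy : ∀ j k x → (j + suc k) * (1 * x) + suc k * 0 ≡ suc (j + k) * x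
    tidy = solve-∀ ℕ-ring
  paths²-rec (suc i) zero k = begin
    (suc i + 0 + suc k) * (paths (suc i) k * 1) + suc k * 0   ≡⟨ tidy i k (paths (suc i) k) ⟩
    suc (suc i + k) * paths (suc i) k                         ≡⟨ [1+k]*paths[a,1+k]≡[1+a+k]*paths[a,k] (suc i) k ⟨
    suc k * paths (suc i) (suc k)                             ≡⟨ cong (suc k *_) (ℕP.*-identityʳ _) ⟨
    suc k * (paths (suc i) (suc k) * 1)                       ∎
    where
    tidy : ∀ i k x → (suc i + 0 + suc k) * (x * 1) + suc k * 0 ≡ suc (suc i + k) * x
    tidy = solve-∀ ℕ-ring
  paths²-rec (suc i) (suc j) k = ℕP.*-cancelˡ-≡ _ _ (suc k) (begin
    suc k * ((suc i + suc j + suc k) * (a * b) + suc k * (paths i (suc k) * paths j (suc k)))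
      ≡⟨ expand i j k a b (paths i (suc k)) (paths j (suc k)) ⟩
    suc k * (suc i + suc j + suc k) * (a * b) + (suc k * paths i (suc k)) * (suc k * paths j (suc k))
      ≡⟨ cong₂ (λ x y → suc k * (suc i + suc j + suc k) * (a * b) + x * y)
               ([1+k]*paths[a,1+k]≡[1+a]*paths[1+a,k] i k) ([1+k]*paths[a,1+k]≡[1+a]*paths[1+a,k] j k) ⟩
    suc k * (suc i + suc j + suc k) * (a * b) + (suc i * a) * (suc j * b)
      ≡⟨ factor i j k a b ⟩
    (suc (suc i + k) * a) * (suc (suc j + k) * b)
      ≡⟨ cong₂ _*_ ([1+k]*paths[a,1+k]≡[1+a+k]*paths[a,k] (suc i) k) ([1+k]*paths[a,1+k]≡[1+a+k]*paths[a,k] (suc j) k) ⟨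
    (suc k * paths (suc i) (suc k)) * (suc k * paths (suc j) (suc k))
      ≡⟨ collect k (paths (suc i) (suc k)) (paths (suc j) (suc k)) ⟩
    suc k * (suc k * paths² (suc k) (suc i) (suc j)) ∎)
    where
    a = paths (suc i) k
    b = paths (suc j) k
    expand : ∀ i j k a b x y → suc k * ((suc i + suc j + suc k) * (a * b) + suc k * (x * y))
                               ≡ suc k * (suc i + suc j + suc k) * (a * b) + (suc k * x) * (suc k * y)
    expand = solve-∀ ℕ-ring
    factor : ∀ i j k a b → suc k * (suc i + suc j + suc k) * (a * b) + (suc i * a) * (suc j * b)
                           ≡ (suc (suc i + k) * a) * (suc (suc j + k) * b)
    factor = solve-∀ ℕ-ring
    collect : ∀ k x y → (suc k * x) * (suc k * y) ≡ suc k * (suc k * (x * y))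
    collect = solve-∀ ℕ-ring

  cross : ℕ → ℕ → ℕ → ℕ
  cross N i j = ((N ∸ j) C i) * ((N ∸ i) C j)

  cross-outside : ∀ N i j → N < i + j → cross N i j ≡ 0
  cross-outside N i j N<i+j with j ℕ.≤? N
  ... | yes j≤N = cong (_* ((N ∸ i) C j)) (k>n⇒nCk≡0 N∸j<i)
    where
    N∸j<i : N ∸ j < i
    N∸j<i = ℕP.+-cancelʳ-< j (N ∸ j) i (subst (_< i + j) (sym (ℕP.m∸n+n≡m j≤N)) N<i+j)
  ... | no  j≰N = trans (cong (((N ∸ j) C i) *_) (k>n⇒nCk≡0 (ℕP.≤-<-trans (ℕP.m∸n≤m N i) (ℕP.≰⇒> j≰N))))
                        (ℕP.*-zeroʳ ((N ∸ j) C i))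

  cross-paths : ∀ i j k → cross (i + j + k) i j ≡ paths² k i j
  cross-paths i j k = cong₂ _*_ (cong (_C i) i+j+k∸j≡i+k) (cong (_C j) i+j+k∸i≡j+k)
    where
    i+j+k∸j≡i+k : i + j + k ∸ j ≡ i + k
    i+j+k∸j≡i+k = trans (cong (_∸ j) (swap i j k)) (ℕP.m+n∸n≡m (i + k) j)
      where
      swap : ∀ i j k → i + j + k ≡ i + k + j
      swap = solve-∀ ℕ-ring
    i+j+k∸i≡j+k : i + j + k ∸ i ≡ j + k
    i+j+k∸i≡j+k = trans (cong (_∸ i) (ℕP.+-assoc i j k)) (ℕP.m+n∸m≡n i (j + k))

  cross-antidiagonal : ∀ N i → i ≤ N → cross N i (N ∸ i) ≡ 1
  cross-antidiagonal N i i≤N rewrite ℕP.m∸[m∸n]≡n i≤N | nCn≡1 i | nCn≡1 (N ∸ i) = refl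

  pascal-∸ : ∀ N j i → j ≤ N → (suc N ∸ j) C suc i ≡ (N ∸ j) C i + (N ∸ j) C suc i
  pascal-∸ N j i j≤N = trans (cong (_C suc i) (ℕP.+-∸-assoc 1 j≤N)) (sym (nCk+nC[k+1]≡[n+1]C[k+1] (N ∸ j) i))

  pascal-∸-diagonal : ∀ N k → (suc N ∸ k) C suc k ≡ (N ∸ k) C k + (N ∸ k) C suc k
  pascal-∸-diagonal N k with k ℕ.≤? N
  ... | yes k≤N = pascal-∸ N k k k≤N
  ... | no  k≰N rewrite ℕP.m≤n⇒m∸n≡0 (ℕP.≰⇒> k≰N) | ℕP.m≤n⇒m∸n≡0 (ℕP.<⇒≤ (ℕP.≰⇒> k≰N))
                      | k>n⇒nCk≡0 {0} {k} (ℕP.≤-<-trans z≤n (ℕP.≰⇒> k≰N)) = refl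

  cross-rec : ∀ N i j → cross (2 + N) i j + shiftˡ (shiftʳ (cross N)) i j
                        ≡ cross (suc N) i j + shiftˡ (cross (suc N)) i j + shiftʳ (cross (suc N)) i j
  cross-rec N zero zero = refl
  cross-rec N zero (suc j) = begin
    1 * (suc (suc N) C suc j) + 0                     ≡⟨ cong (λ x → 1 * x + 0) (nCk+nC[k+1]≡[n+1]C[k+1] (suc N) j) ⟨
    1 * (suc N C j + suc N C suc j) + 0               ≡⟨ reorder (suc N C j) (suc N C suc j) ⟩
    1 * (suc N C suc j) + 0 + 1 * (suc N C j)         ∎
    where
    reorder : ∀ x y → 1 * (x + y) + 0 ≡ 1 * y + 0 + 1 * x
    reorder = solve-∀ ℕ-ring
  cross-rec N (suc i) zero = begin
    (suc (suc N) C suc i) * 1 + 0                     ≡⟨ cong (λ x → x * 1 + 0) (nCk+nC[k+1]≡[n+1]C[k+1] (suc N) i) ⟨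
    (suc N C i + suc N C suc i) * 1 + 0               ≡⟨ reorder (suc N C i) (suc N C suc i) ⟩
    (suc N C suc i) * 1 + (suc N C i) * 1 + 0         ∎
    where
    reorder : ∀ x y → (x + y) * 1 + 0 ≡ y * 1 + x * 1 + 0
    reorder = solve-∀ ℕ-ring
  cross-rec N (suc i) (suc j) with i + j ℕ.≤? N
  ... | yes i+j≤N = begin
    ((suc N ∸ j) C suc i) * ((suc N ∸ i) C suc j) + A * B
      ≡⟨ cong₂ (λ x y → x * y + A * B) (pascal-∸ N j i j≤N) (pascal-∸ N i j i≤N) ⟩
    (A + A′) * (B + B′) + A * B
      ≡⟨ pascal-square A A′ B B′ ⟩
    A′ * B′ + A * (B + B′) + (A + A′) * B
      ≡⟨ cong₂ (λ x y → A′ * B′ + A * x + y * B) (pascal-∸ N i j i≤N) (pascal-∸ N j i j≤N) ⟨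
    A′ * B′ + A * ((suc N ∸ i) C suc j) + ((suc N ∸ j) C suc i) * B ∎
    where
    A = (N ∸ j) C i
    A′ = (N ∸ j) C suc i
    B = (N ∸ i) C j
    B′ = (N ∸ i) C suc j
    i≤N : i ≤ N
    i≤N = ℕP.≤-trans (ℕP.m≤m+n i j) i+j≤N
    j≤N : j ≤ N
    j≤N = ℕP.≤-trans (ℕP.m≤n+m j i) i+j≤N
    pascal-square : ∀ A A′ B B′ → (A + A′) * (B + B′) + A * B ≡ A′ * B′ + A * (B + B′) + (A + A′) * B
    pascal-square = solve-∀ ℕ-ring
  ... | no i+j≰N = begin
    cross (2 + N) (suc i) (suc j) + cross N i j
      ≡⟨ cong₂ _+_ (cross-outside (2 + N) (suc i) (suc j) (s≤s 1+N<i+1+j)) (cross-outside N i j N<i+j) ⟩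
    0
      ≡⟨ cong₂ _+_ (cong₂ _+_ (cross-outside (suc N) (suc i) (suc j) (ℕP.m<n⇒m<1+n 1+N<i+1+j))
                              (cross-outside (suc N) i (suc j) 1+N<i+1+j))
                   (cross-outside (suc N) (suc i) j (s≤s N<i+j)) ⟨
    cross (suc N) (suc i) (suc j) + cross (suc N) i (suc j) + cross (suc N) (suc i) j ∎
    where
    N<i+j : N < i + j
    N<i+j = ℕP.≰⇒> i+j≰N
    1+N<i+1+j : suc N < i + suc j
    1+N<i+1+j = subst (suc N <_) (sym (ℕP.+-suc i j)) (s≤s N<i+j)

  shift²-cross-outside : ∀ M i j → 2 + M < i + j → shiftˡ (shiftʳ (cross M)) i j ≡ 0
  shift²-cross-outside M zero    j       _ = refl
  shift²-cross-outside M (suc i) zero    _ = refl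
  shift²-cross-outside M (suc i) (suc j) 2+M<i+j =
    cross-outside M i j (ℕP.≤-pred (ℕP.≤-pred (subst (3 + M ≤_) (ℕP.+-suc (suc i) j) 2+M<i+j)))

  shift²-cross-antidiagonal : ∀ M i → i ≤ M → shiftˡ (shiftʳ (cross M)) (suc i) (suc M ∸ i) ≡ 1
  shift²-cross-antidiagonal M i i≤M rewrite ℕP.+-∸-assoc 1 i≤M = cross-antidiagonal M i i≤M

  rhoCoefficient : ℕ → ℕ → ℕ → ℕ
  rhoCoefficient m d i = (((m ∸ 1 ∸ d) + i) C i) * ((m ∸ 1 ∸ i) C (d ∸ i))

  shift²-cross : ∀ M i j k → 2 + M ≡ i + j + suc k →
                 shiftˡ (shiftʳ (cross M)) i j ≡ shiftˡ (shiftʳ (paths² (suc k))) i j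
  shift²-cross M zero    j       k eq = refl
  shift²-cross M (suc i) zero    k eq = refl
  shift²-cross M (suc i) (suc j) k eq = trans (cong (λ n → cross n i j) M≡i+j+1+k) (cross-paths i j (suc k))
    where
    M≡i+j+1+k : M ≡ i + j + suc k
    M≡i+j+1+k = ℕP.suc-injective (ℕP.suc-injective (trans eq (cong (λ n → suc (n + suc k)) (ℕP.+-suc i j))))

  rhoCoefficient-cross : ∀ M d i → d ≤ suc M → i ≤ d →
    (2 + M) * rhoCoefficient (2 + M) d i + suc (suc M ∸ d) * shiftˡ (shiftʳ (cross M)) i (d ∸ i)
    ≡ suc (suc M ∸ d) * cross (2 + M) i (d ∸ i)
  rhoCoefficient-cross M d i d≤1+M i≤d = begin
    (2 + M) * rhoCoefficient (2 + M) d i + suc k * shiftˡ (shiftʳ (cross M)) i j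
      ≡⟨ cong₂ _+_ (cong₂ _*_ 2+M≡i+j+1+k rhoCoefficient≡paths²) (cong (suc k *_) (shift²-cross M i j k 2+M≡i+j+1+k)) ⟩
    (i + j + suc k) * paths² k i j + suc k * shiftˡ (shiftʳ (paths² (suc k))) i j
      ≡⟨ paths²-rec i j k ⟩
    suc k * paths² (suc k) i j
      ≡⟨ cong (suc k *_) (trans (cong (λ n → cross n i j) 2+M≡i+j+1+k) (cross-paths i j (suc k))) ⟨
    suc k * cross (2 + M) i j
      ∎
    where
    j = d ∸ i
    k = suc M ∸ d
    i+j≡d : i + j ≡ d
    i+j≡d = ℕP.m+[n∸m]≡n i≤d
    i+[j+k]≡1+M : i + (j + k) ≡ suc M
    i+[j+k]≡1+M = trans (sym (ℕP.+-assoc i j k)) (trans (cong (_+ k) i+j≡d) (ℕP.m+[n∸m]≡n d≤1+M))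
    2+M≡i+j+1+k : 2 + M ≡ i + j + suc k
    2+M≡i+j+1+k = sym (trans (ℕP.+-suc (i + j) k) (cong suc (trans (ℕP.+-assoc i j k) i+[j+k]≡1+M)))
    rhoCoefficient≡paths² : rhoCoefficient (2 + M) d i ≡ paths² k i j
    rhoCoefficient≡paths² = cong₂ _*_ (cong (_C i) (ℕP.+-comm k i))
                                      (cong (_C j) (trans (cong (_∸ i) (sym i+[j+k]≡1+M)) (ℕP.m+n∸m≡n i (j + k))))

  lucasCoefficient : ∀ a i → (2 + (a + i)) * (suc a C suc i) ≡ suc a * (suc a C suc i + a C i)
  lucasCoefficient a i = begin
    (2 + (a + i)) * c                   ≡⟨ split a i c ⟩
    suc a * c + suc i * c               ≡⟨ cong (λ x → suc a * c + x) ([1+k]*[1+n]C[1+k]≡[1+n]*nCk a i) ⟩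
    suc a * c + suc a * (a C i)         ≡⟨ ℕP.*-distribˡ-+ (suc a) c (a C i) ⟨
    suc a * (c + a C i)                 ∎
    where
    c = suc a C suc i
    split : ∀ a i c → (2 + (a + i)) * c ≡ suc a * c + suc i * c
    split = solve-∀ ℕ-ring

  m/2<i⇒[m∸i]Ci≡0 : ∀ m i → m / 2 < i → (m ∸ i) C i ≡ 0
  m/2<i⇒[m∸i]Ci≡0 m i m/2<i = k>n⇒nCk≡0 (ℕP.m<n+o⇒m∸n<o m i {{ℕ.>-nonZero (ℕP.≤-<-trans z≤n m/2<i)}} m<i+i)
    where
    i+i≡i*2 : ∀ i → i + i ≡ i * 2
    i+i≡i*2 = solve-∀ ℕ-ring
    m<i+i : m < i + i
    m<i+i = ℕP.≰⇒> (λ i+i≤m → ℕP.<⇒≱ m/2<i (subst (_≤ m / 2) (m*n/n≡m i 2) (/-monoˡ-≤ 2 (subst (_≤ m) (i+i≡i*2 i) i+i≤m))))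

  [2+N]∸2[1+k]≡N∸2k : ∀ N k → 2 + N ∸ 2 * suc k ≡ N ∸ 2 * k
  [2+N]∸2[1+k]≡N∸2k N k rewrite ℕP.+-suc k (k + 0) = refl

  [1+N]∸2[1+k]≡N∸[1+2k] : ∀ N k → suc N ∸ 2 * suc k ≡ N ∸ suc (2 * k)
  [1+N]∸2[1+k]≡N∸[1+2k] N k rewrite ℕP.+-suc k (k + 0) = refl

open Coefficients
-- Opened only here so that, inside Coefficients, + and * are the operations of ℕ.
open import Data.Rational using (_+_; _-_; _*_; -_)

ℚ-ring : AlmostCommutativeRing 0ℓ 0ℓ
ℚ-ring = fromCommutativeRing ℚP.+-*-commutativeRing (λ x → dec⇒maybe (0ℚ ℚP.≟ x))

-- Natural numbers and fractions in ℚ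

nat≃mkℚᵘ : ∀ a → toℚᵘ (nat a) ℚᵘ.≃ mkℚᵘ (ℤ.+ a) 0
nat≃mkℚᵘ a = toℚᵘ-fromℚᵘ (mkℚᵘ (ℤ.+ a) 0)

nat-homo-+ : ∀ a b → nat (a ℕ.+ b) ≡ nat a + nat b
nat-homo-+ a b = toℚᵘ-injective (begin
  toℚᵘ (nat (a ℕ.+ b))                ≈⟨ nat≃mkℚᵘ (a ℕ.+ b) ⟩
  mkℚᵘ (ℤ.+ (a ℕ.+ b)) 0              ≈⟨ ℚᵘ.*≡* (trans (cong (ℤ._* ℤ.+ 1) (ℤP.pos-+ a b)) (sum-over-one (ℤ.+ a) (ℤ.+ b))) ⟩
  mkℚᵘ (ℤ.+ a) 0 ℚᵘ.+ mkℚᵘ (ℤ.+ b) 0  ≈⟨ ℚᵘP.+-cong (nat≃mkℚᵘ a) (nat≃mkℚᵘ b) ⟨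
  toℚᵘ (nat a) ℚᵘ.+ toℚᵘ (nat b)      ≈⟨ toℚᵘ-homo-+ (nat a) (nat b) ⟨
  toℚᵘ (nat a + nat b)                ∎)
  where
  open ℚᵘP.≃-Reasoning
  sum-over-one : ∀ x y → (x ℤ.+ y) ℤ.* ℤ.+ 1 ≡ (x ℤ.* ℤ.+ 1 ℤ.+ y ℤ.* ℤ.+ 1) ℤ.* ℤ.+ 1
  sum-over-one = solve-∀ ℤ-ring

nat-homo-* : ∀ a b → nat (a ℕ.* b) ≡ nat a * nat b
nat-homo-* a b = toℚᵘ-injective (begin
  toℚᵘ (nat (a ℕ.* b))                ≈⟨ nat≃mkℚᵘ (a ℕ.* b) ⟩
  mkℚᵘ (ℤ.+ (a ℕ.* b)) 0              ≈⟨ ℚᵘ.*≡* (cong (ℤ._* ℤ.+ 1) (ℤP.pos-* a b)) ⟩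
  mkℚᵘ (ℤ.+ a) 0 ℚᵘ.* mkℚᵘ (ℤ.+ b) 0  ≈⟨ ℚᵘP.*-cong (nat≃mkℚᵘ a) (nat≃mkℚᵘ b) ⟨
  toℚᵘ (nat a) ℚᵘ.* toℚᵘ (nat b)      ≈⟨ toℚᵘ-homo-* (nat a) (nat b) ⟨
  toℚᵘ (nat a * nat b)                ∎)
  where open ℚᵘP.≃-Reasoning

frac-*-denominator : ∀ a b → frac a (suc b) * nat (suc b) ≡ nat a
frac-*-denominator a b = toℚᵘ-injective (begin
  toℚᵘ (frac a (suc b) * nat (suc b))            ≈⟨ toℚᵘ-homo-* (frac a (suc b)) (nat (suc b)) ⟩
  toℚᵘ (frac a (suc b)) ℚᵘ.* toℚᵘ (nat (suc b))  ≈⟨ ℚᵘP.*-cong (toℚᵘ-fromℚᵘ (mkℚᵘ (ℤ.+ a) b)) (nat≃mkℚᵘ (suc b)) ⟩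
  mkℚᵘ (ℤ.+ a) b ℚᵘ.* mkℚᵘ (ℤ.+ suc b) 0         ≈⟨ ℚᵘ.*≡* (trans (ℤP.*-identityʳ _) (cong (λ n → ℤ.+ a ℤ.* ℤ.+ n) (sym (ℕP.*-identityʳ (suc b))))) ⟩
  mkℚᵘ (ℤ.+ a) 0                                 ≈⟨ nat≃mkℚᵘ a ⟨
  toℚᵘ (nat a)                                   ∎)
  where open ℚᵘP.≃-Reasoning

*-cancelʳ-nat-suc : ∀ b {x y} → x * nat (suc b) ≡ y * nat (suc b) → x ≡ y
*-cancelʳ-nat-suc b {x} {y} eq = begin
  x                   ≡⟨ ℚP.*-identityʳ x ⟨
  x * 1ℚ              ≡⟨ cong (x *_) (frac-*-denominator 1 b) ⟨
  x * (w * n)         ≡⟨ swap x w n ⟩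
  (x * n) * w         ≡⟨ cong (_* w) eq ⟩
  (y * n) * w         ≡⟨ swap y w n ⟨
  y * (w * n)         ≡⟨ cong (y *_) (frac-*-denominator 1 b) ⟩
  y * 1ℚ              ≡⟨ ℚP.*-identityʳ y ⟩
  y                   ∎
  where
  open ≡-Reasoning
  n = nat (suc b)
  w = frac 1 (suc b)
  swap : ∀ x w n → x * (w * n) ≡ (x * n) * w
  swap = solve-∀ ℚ-ring

frac-*-nat : ∀ a b c r r′ → a ℕ.* c ℕ.+ suc b ℕ.* r ≡ suc b ℕ.* r′ →
             frac a (suc b) * nat c ≡ nat r′ - nat r
frac-*-nat a b c r r′ eq = *-cancelʳ-nat-suc b (begin
  frac a (suc b) * nat c * n                  ≡⟨ swap (frac a (suc b)) (nat c) n ⟩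
  frac a (suc b) * n * nat c                  ≡⟨ cong (_* nat c) (frac-*-denominator a b) ⟩
  nat a * nat c                               ≡⟨ nat-homo-* a c ⟨
  nat (a ℕ.* c)                               ≡⟨ add-sub (nat (a ℕ.* c)) (nat (suc b ℕ.* r)) ⟩
  nat (a ℕ.* c) + nat (suc b ℕ.* r) - nat (suc b ℕ.* r)
    ≡⟨ cong (_- nat (suc b ℕ.* r)) (trans (sym (nat-homo-+ (a ℕ.* c) (suc b ℕ.* r))) (cong nat eq)) ⟩
  nat (suc b ℕ.* r′) - nat (suc b ℕ.* r)      ≡⟨ cong₂ _-_ (nat-homo-* (suc b) r′) (nat-homo-* (suc b) r) ⟩
  n * nat r′ - n * nat r                      ≡⟨ factor n (nat r′) (nat r) ⟩
  (nat r′ - nat r) * n                        ∎)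
  where
  open ≡-Reasoning
  n = nat (suc b)
  swap : ∀ x y z → x * y * z ≡ x * z * y
  swap = solve-∀ ℚ-ring
  add-sub : ∀ x y → x ≡ x + y - y
  add-sub = solve-∀ ℚ-ring
  factor : ∀ n x y → n * x - n * y ≡ (x - y) * n
  factor = solve-∀ ℚ-ring

frac-self : ∀ n → frac (suc n) (suc n) ≡ 1ℚ
frac-self n = *-cancelʳ-nat-suc n (trans (frac-*-denominator (suc n) n) (sym (ℚP.*-identityˡ (nat (suc n)))))

pow-+ : ∀ x i j → pow x (i ℕ.+ j) ≡ pow x i * pow x j
pow-+ x zero    j = sym (ℚP.*-identityˡ (pow x j))
pow-+ x (suc i) j = trans (cong (x *_) (pow-+ x i j)) (sym (ℚP.*-assoc x (pow x i) (pow x j)))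

pow-distrib-* : ∀ x y i → pow (x * y) i ≡ pow x i * pow y i
pow-distrib-* x y zero    = refl
pow-distrib-* x y (suc i) = trans (cong ((x * y) *_) (pow-distrib-* x y i)) (interchange x y (pow x i) (pow y i))
  where
  interchange : ∀ x y a b → (x * y) * (a * b) ≡ (x * a) * (y * b)
  interchange = solve-∀ ℚ-ring

-- Finite sums

sumTo-cong : ∀ n {f g : ℕ → ℚ} → (∀ k → k ≤ n → f k ≡ g k) → sumTo n f ≡ sumTo n g
sumTo-cong zero    f≗g = f≗g 0 z≤n
sumTo-cong (suc n) f≗g = cong₂ _+_ (sumTo-cong n (λ k k≤n → f≗g k (ℕP.m≤n⇒m≤1+n k≤n))) (f≗g (suc n) ℕP.≤-refl)

sumTo-zero : ∀ n (f : ℕ → ℚ) → (∀ k → k ≤ n → f k ≡ 0ℚ) → sumTo n f ≡ 0ℚ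
sumTo-zero n f f≗0 = trans (sumTo-cong n f≗0) (sumTo-0ℚ n)
  where
  sumTo-0ℚ : ∀ n → sumTo n (λ _ → 0ℚ) ≡ 0ℚ
  sumTo-0ℚ zero    = refl
  sumTo-0ℚ (suc n) = cong (_+ 0ℚ) (sumTo-0ℚ n)

sumTo-distrib-+ : ∀ n (f g : ℕ → ℚ) → sumTo n (λ k → f k + g k) ≡ sumTo n f + sumTo n g
sumTo-distrib-+ zero    f g = refl
sumTo-distrib-+ (suc n) f g =
  trans (cong (_+ (f (suc n) + g (suc n))) (sumTo-distrib-+ n f g))
        (interchange (sumTo n f) (sumTo n g) (f (suc n)) (g (suc n)))
  where
  interchange : ∀ a b c d → (a + b) + (c + d) ≡ (a + c) + (b + d)
  interchange = solve-∀ ℚ-ring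

sumTo-neg : ∀ n (f : ℕ → ℚ) → sumTo n (λ k → - f k) ≡ - sumTo n f
sumTo-neg zero    f = refl
sumTo-neg (suc n) f = trans (cong (_+ - f (suc n)) (sumTo-neg n f)) (sym (ℚP.neg-distrib-+ (sumTo n f) (f (suc n))))

sumTo-*ˡ : ∀ n c (f : ℕ → ℚ) → sumTo n (λ k → c * f k) ≡ c * sumTo n f
sumTo-*ˡ zero    c f = refl
sumTo-*ˡ (suc n) c f = trans (cong (_+ c * f (suc n)) (sumTo-*ˡ n c f)) (sym (ℚP.*-distribˡ-+ c (sumTo n f) (f (suc n))))

sumTo-*ʳ : ∀ n c (f : ℕ → ℚ) → sumTo n f * c ≡ sumTo n (λ k → f k * c)
sumTo-*ʳ zero    c f = refl
sumTo-*ʳ (suc n) c f = trans (ℚP.*-distribʳ-+ c (sumTo n f) (f (suc n))) (cong (_+ f (suc n) * c) (sumTo-*ʳ n c f))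

sumTo-suc : ∀ n (f : ℕ → ℚ) → sumTo (suc n) f ≡ f 0 + sumTo n (λ k → f (suc k))
sumTo-suc zero    f = refl
sumTo-suc (suc n) f = trans (cong (_+ f (2 ℕ.+ n)) (sumTo-suc n f)) (ℚP.+-assoc (f 0) _ _)

sumTo-drop-last : ∀ n (f : ℕ → ℚ) → f (suc n) ≡ 0ℚ → sumTo (suc n) f ≡ sumTo n f
sumTo-drop-last n f f[1+n]≡0 = trans (cong (sumTo n f +_) f[1+n]≡0) (ℚP.+-identityʳ (sumTo n f))

sumTo-extend : ∀ n N (f : ℕ → ℚ) → n ≤ N → (∀ k → n < k → f k ≡ 0ℚ) → sumTo N f ≡ sumTo n f
sumTo-extend n N f n≤N f≗0 = trans (cong (λ m → sumTo m f) (sym (ℕP.m∸n+n≡m n≤N))) (go (N ∸ n))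
  where
  go : ∀ j → sumTo (j ℕ.+ n) f ≡ sumTo n f
  go zero    = refl
  go (suc j) = trans (cong₂ _+_ (go j) (f≗0 (suc (j ℕ.+ n)) (s≤s (ℕP.m≤n+m n j)))) (ℚP.+-identityʳ _)

sumTo-triangle : ∀ n (g : ℕ → ℕ → ℚ) →
  sumTo n (λ d → sumTo d (λ i → g i (d ∸ i))) ≡ sumTo n (λ i → sumTo (n ∸ i) (g i))
sumTo-triangle zero    g = refl
sumTo-triangle (suc n) g = begin
  sumTo n (λ d → sumTo d (λ i → g i (d ∸ i))) + (sumTo n (λ i → g i (suc n ∸ i)) + g (suc n) (n ∸ n))
    ≡⟨ cong₂ (λ x y → x + (sumTo n (λ i → g i (suc n ∸ i)) + g (suc n) y)) (sumTo-triangle n g) (ℕP.n∸n≡0 n) ⟩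
  sumTo n (λ i → sumTo (n ∸ i) (g i)) + (sumTo n (λ i → g i (suc n ∸ i)) + g (suc n) 0)
    ≡⟨ ℚP.+-assoc (sumTo n (λ i → sumTo (n ∸ i) (g i))) (sumTo n (λ i → g i (suc n ∸ i))) (g (suc n) 0) ⟨
  sumTo n (λ i → sumTo (n ∸ i) (g i)) + sumTo n (λ i → g i (suc n ∸ i)) + g (suc n) 0
    ≡⟨ cong (_+ g (suc n) 0) (sumTo-distrib-+ n _ _) ⟨
  sumTo n (λ i → sumTo (n ∸ i) (g i) + g i (suc n ∸ i)) + g (suc n) 0
    ≡⟨ cong₂ _+_ (sumTo-cong n extend-row) (cong (λ m → sumTo m (g (suc n))) (ℕP.n∸n≡0 n)) ⟨
  sumTo n (λ i → sumTo (suc n ∸ i) (g i)) + sumTo (n ∸ n) (g (suc n))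
    ∎
  where
  open ≡-Reasoning
  extend-row : ∀ i → i ≤ n → sumTo (suc n ∸ i) (g i) ≡ sumTo (n ∸ i) (g i) + g i (suc n ∸ i)
  extend-row i i≤n rewrite ℕP.+-∸-assoc 1 i≤n = refl

sumRect : ℕ → ℕ → (ℕ → ℕ → ℚ) → ℚ
sumRect I J g = sumTo I (λ i → sumTo J (g i))

sumRect-cong : ∀ I J {g h : ℕ → ℕ → ℚ} → (∀ i j → g i j ≡ h i j) → sumRect I J g ≡ sumRect I J h
sumRect-cong I J g≗h = sumTo-cong I (λ i _ → sumTo-cong J (λ j _ → g≗h i j))

sumRect-distrib-+ : ∀ I J (g h : ℕ → ℕ → ℚ) → sumRect I J (λ i j → g i j + h i j) ≡ sumRect I J g + sumRect I J h
sumRect-distrib-+ I J g h = trans (sumTo-cong I (λ i _ → sumTo-distrib-+ J (g i) (h i))) (sumTo-distrib-+ I _ _)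

sumRect-neg : ∀ I J (g : ℕ → ℕ → ℚ) → sumRect I J (λ i j → - g i j) ≡ - sumRect I J g
sumRect-neg I J g = trans (sumTo-cong I (λ i _ → sumTo-neg J (g i))) (sumTo-neg I _)

sumRect-*ˡ : ∀ I J c (g : ℕ → ℕ → ℚ) → sumRect I J (λ i j → c * g i j) ≡ c * sumRect I J g
sumRect-*ˡ I J c g = trans (sumTo-cong I (λ i _ → sumTo-*ˡ J c (g i))) (sumTo-*ˡ I c _)

sumRect-extend : ∀ N I J (g : ℕ → ℕ → ℚ) → N ≤ I → N ≤ J → (∀ i j → N < i ℕ.+ j → g i j ≡ 0ℚ) →
                 sumRect I J g ≡ sumRect N N g
sumRect-extend N I J g N≤I N≤J g≗0 =
  trans (sumTo-cong I (λ i _ → sumTo-extend N J (g i) N≤J (λ j N<j → g≗0 i j (ℕP.<-≤-trans N<j (ℕP.m≤n+m j i)))))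
        (sumTo-extend N I _ N≤I (λ i N<i → sumTo-zero N (g i) (λ j _ → g≗0 i j (ℕP.<-≤-trans N<i (ℕP.m≤m+n i j)))))

sumTo-antidiagonals : ∀ n (g : ℕ → ℕ → ℚ) → (∀ i j → n < i ℕ.+ j → g i j ≡ 0ℚ) →
                      sumTo n (λ d → sumTo d (λ i → g i (d ∸ i))) ≡ sumRect n n g
sumTo-antidiagonals n g g≗0 = trans (sumTo-triangle n g) (sumTo-cong n (λ i i≤n → sym (row i i≤n)))
  where
  n<i+j : ∀ i j → i ≤ n → n ∸ i < j → n < i ℕ.+ j
  n<i+j i j i≤n n∸i<j = subst (_< i ℕ.+ j) (ℕP.m+[n∸m]≡n i≤n) (ℕP.+-monoʳ-< i n∸i<j)
  row : ∀ i → i ≤ n → sumTo n (g i) ≡ sumTo (n ∸ i) (g i)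
  row i i≤n = sumTo-extend (n ∸ i) n (g i) (ℕP.m∸n≤m n i) (λ j n∸i<j → g≗0 i j (n<i+j i j i≤n n∸i<j))

module Bivariate (u v : ℚ) where
  open ≡-Reasoning

  monomial : ℕ → ℕ → ℚ
  monomial i j = pow u i * pow v j

  poly : ℕ → ℕ → (ℕ → ℕ → ℕ) → ℚ
  poly I J c = sumRect I J (λ i j → nat (c i j) * monomial i j)

  poly-cong : ∀ I J {c d : ℕ → ℕ → ℕ} → (∀ i j → c i j ≡ d i j) → poly I J c ≡ poly I J d
  poly-cong I J c≗d = sumRect-cong I J (λ i j → cong (λ n → nat n * monomial i j) (c≗d i j))

  poly-+ : ∀ I J (c d : ℕ → ℕ → ℕ) → poly I J (λ i j → c i j ℕ.+ d i j) ≡ poly I J c + poly I J d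
  poly-+ I J c d = trans (sumRect-cong I J distrib) (sumRect-distrib-+ I J _ _)
    where
    distrib : ∀ i j → nat (c i j ℕ.+ d i j) * monomial i j ≡ nat (c i j) * monomial i j + nat (d i j) * monomial i j
    distrib i j = trans (cong (_* monomial i j) (nat-homo-+ (c i j) (d i j))) (ℚP.*-distribʳ-+ (monomial i j) (nat (c i j)) (nat (d i j)))

  poly-extend : ∀ N I J (c : ℕ → ℕ → ℕ) → N ≤ I → N ≤ J → (∀ i j → N < i ℕ.+ j → c i j ≡ 0) →
                poly I J c ≡ poly N N c
  poly-extend N I J c N≤I N≤J c≗0 =
    sumRect-extend N I J _ N≤I N≤J (λ i j N<i+j → trans (cong (λ n → nat n * monomial i j) (c≗0 i j N<i+j)) (ℚP.*-zeroˡ (monomial i j)))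

  poly-shiftˡ : ∀ I J (c : ℕ → ℕ → ℕ) → poly (suc I) J (shiftˡ c) ≡ u * poly I J c
  poly-shiftˡ I J c = begin
    poly (suc I) J (shiftˡ c)
      ≡⟨ sumTo-suc I _ ⟩
    sumTo J (λ j → 0ℚ * monomial 0 j) + sumRect I J (λ i j → nat (c i j) * (u * pow u i * pow v j))
      ≡⟨ cong₂ _+_ (sumTo-zero J _ (λ j _ → ℚP.*-zeroˡ (monomial 0 j))) (sumRect-cong I J (λ i j → pull-out (nat (c i j)) u (pow u i) (pow v j))) ⟩
    0ℚ + sumRect I J (λ i j → u * (nat (c i j) * monomial i j))
      ≡⟨ trans (ℚP.+-identityˡ _) (sumRect-*ˡ I J u _) ⟩
    u * poly I J c ∎
    where
    pull-out : ∀ c u a b → c * (u * a * b) ≡ u * (c * (a * b))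
    pull-out = solve-∀ ℚ-ring

  poly-shiftʳ : ∀ I J (c : ℕ → ℕ → ℕ) → poly I (suc J) (shiftʳ c) ≡ v * poly I J c
  poly-shiftʳ I J c = begin
    poly I (suc J) (shiftʳ c)
      ≡⟨ sumTo-cong I (λ i _ → sumTo-suc J _) ⟩
    sumTo I (λ i → 0ℚ * monomial i 0 + sumTo J (λ j → nat (c i j) * (pow u i * (v * pow v j))))
      ≡⟨ sumTo-cong I (λ i _ → trans (cong (_+ row i) (ℚP.*-zeroˡ (monomial i 0))) (ℚP.+-identityˡ (row i))) ⟩
    sumRect I J (λ i j → nat (c i j) * (pow u i * (v * pow v j)))
      ≡⟨ sumRect-cong I J (λ i j → pull-out (nat (c i j)) v (pow u i) (pow v j)) ⟩
    sumRect I J (λ i j → v * (nat (c i j) * monomial i j))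
      ≡⟨ sumRect-*ˡ I J v _ ⟩
    v * poly I J c ∎
    where
    row : ℕ → ℚ
    row i = sumTo J (λ j → nat (c i j) * (pow u i * (v * pow v j)))
    pull-out : ∀ c v a b → c * (a * (v * b)) ≡ v * (c * (a * b))
    pull-out = solve-∀ ℚ-ring

  crossPoly : ℕ → ℚ
  crossPoly N = poly N N (cross N)

  poly-cross-extend : ∀ N I J → N ≤ I → N ≤ J → poly I J (cross N) ≡ crossPoly N
  poly-cross-extend N I J N≤I N≤J = poly-extend N I J (cross N) N≤I N≤J (cross-outside N)

  poly-shift²-cross : ∀ N → poly (2 ℕ.+ N) (2 ℕ.+ N) (shiftˡ (shiftʳ (cross N))) ≡ u * (v * crossPoly N)
  poly-shift²-cross N = begin
    poly (2 ℕ.+ N) (2 ℕ.+ N) (shiftˡ (shiftʳ (cross N)))   ≡⟨ poly-shiftˡ (suc N) (2 ℕ.+ N) (shiftʳ (cross N)) ⟩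
    u * poly (suc N) (2 ℕ.+ N) (shiftʳ (cross N))          ≡⟨ cong (u *_) (poly-shiftʳ (suc N) (suc N) (cross N)) ⟩
    u * (v * poly (suc N) (suc N) (cross N))               ≡⟨ cong (λ p → u * (v * p)) (poly-cross-extend N (suc N) (suc N) N≤1+N N≤1+N) ⟩
    u * (v * crossPoly N)                                  ∎
    where
    N≤1+N = ℕP.n≤1+n N

  crossPoly-rec : ∀ N → crossPoly (2 ℕ.+ N) ≡ (1ℚ + u + v) * crossPoly (suc N) + - (u * v) * crossPoly N
  crossPoly-rec N = begin
    crossPoly m                                  ≡⟨ add-sub (crossPoly m) (u * (v * G₀)) ⟩
    crossPoly m + u * (v * G₀) - u * (v * G₀)    ≡⟨ cong (λ x → x - u * (v * G₀)) pascal ⟩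
    G₁ + u * G₁ + v * G₁ - u * (v * G₀)          ≡⟨ collect u v G₀ G₁ ⟩
    (1ℚ + u + v) * G₁ + - (u * v) * G₀           ∎
    where
    m = 2 ℕ.+ N
    G₀ = crossPoly N
    G₁ = crossPoly (suc N)
    c = cross (suc N)
    1+N≤m = ℕP.n≤1+n (suc N)
    add-sub : ∀ x y → x ≡ x + y - y
    add-sub = solve-∀ ℚ-ring
    collect : ∀ u v G₀ G₁ → G₁ + u * G₁ + v * G₁ - u * (v * G₀) ≡ (1ℚ + u + v) * G₁ + - (u * v) * G₀
    collect = solve-∀ ℚ-ring
    pascal : crossPoly m + u * (v * G₀) ≡ G₁ + u * G₁ + v * G₁
    pascal = begin
      crossPoly m + u * (v * G₀)
        ≡⟨ cong (λ x → crossPoly m + x) (poly-shift²-cross N) ⟨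
      poly m m (cross m) + poly m m (shiftˡ (shiftʳ (cross N)))
        ≡⟨ poly-+ m m (cross m) (shiftˡ (shiftʳ (cross N))) ⟨
      poly m m (λ i j → cross m i j ℕ.+ shiftˡ (shiftʳ (cross N)) i j)
        ≡⟨ poly-cong m m (cross-rec N) ⟩
      poly m m (λ i j → c i j ℕ.+ shiftˡ c i j ℕ.+ shiftʳ c i j)
        ≡⟨ poly-+ m m (λ i j → c i j ℕ.+ shiftˡ c i j) (shiftʳ c) ⟩
      poly m m (λ i j → c i j ℕ.+ shiftˡ c i j) + poly m m (shiftʳ c)
        ≡⟨ cong (_+ poly m m (shiftʳ c)) (poly-+ m m c (shiftˡ c)) ⟩
      poly m m c + poly m m (shiftˡ c) + poly m m (shiftʳ c)
        ≡⟨ cong₂ (λ x y → poly m m c + x + y) (poly-shiftˡ (suc N) m c) (poly-shiftʳ m (suc N) c) ⟩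
      poly m m c + u * poly (suc N) m c + v * poly m (suc N) c
        ≡⟨ cong₂ (λ x y → x + u * y + v * poly m (suc N) c)
                 (poly-cross-extend (suc N) m m 1+N≤m 1+N≤m) (poly-cross-extend (suc N) (suc N) m ℕP.≤-refl 1+N≤m) ⟩
      G₁ + u * G₁ + v * poly m (suc N) c
        ≡⟨ cong (λ x → G₁ + u * G₁ + v * x) (poly-cross-extend (suc N) m (suc N) 1+N≤m ℕP.≤-refl) ⟩
      G₁ + u * G₁ + v * G₁ ∎

module Fibonacci (x s : ℚ) where
  open ≡-Reasoning

  fibTerm : ℕ → ℕ → ℚ
  fibTerm N k = nat ((N ∸ k) C k) * (pow s k * pow x (N ∸ 2 ℕ.* k))

  fibPoly : ℕ → ℚ
  fibPoly N = sumTo N (fibTerm N)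

  fibTerm-beyond : ∀ N → fibTerm N (suc N) ≡ 0ℚ
  fibTerm-beyond N = trans (cong (λ n → nat (n C suc N) * W) (ℕP.m≤n⇒m∸n≡0 (ℕP.n≤1+n N))) (ℚP.*-zeroˡ W)
    where
    W = pow s (suc N) * pow x (N ∸ 2 ℕ.* suc N)

  x-shift : ∀ N k → nat ((N ∸ k) C suc k) * pow x (N ∸ 2 ℕ.* k)
                    ≡ x * (nat ((N ∸ k) C suc k) * pow x (suc N ∸ 2 ℕ.* suc k))
  x-shift N k = by-cases (suc (2 ℕ.* k) ℕ.≤? N)
    where
    c = (N ∸ k) C suc k
    by-cases : Dec (suc (2 ℕ.* k) ≤ N) → nat c * pow x (N ∸ 2 ℕ.* k) ≡ x * (nat c * pow x (suc N ∸ 2 ℕ.* suc k))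
    by-cases (yes 1+2k≤N) = begin
      nat c * pow x (N ∸ 2 ℕ.* k)                 ≡⟨ cong (λ e → nat c * pow x e) (ℕP.+-∸-assoc 1 1+2k≤N) ⟩
      nat c * (x * pow x (N ∸ suc (2 ℕ.* k)))     ≡⟨ cong (λ e → nat c * (x * pow x e)) ([1+N]∸2[1+k]≡N∸[1+2k] N k) ⟨
      nat c * (x * pow x (suc N ∸ 2 ℕ.* suc k))   ≡⟨ swap (nat c) x (pow x (suc N ∸ 2 ℕ.* suc k)) ⟩
      x * (nat c * pow x (suc N ∸ 2 ℕ.* suc k))   ∎
      where
      swap : ∀ c x p → c * (x * p) ≡ x * (c * p)
      swap = solve-∀ ℚ-ring
    by-cases (no 1+2k≰N) = begin
      nat c * pow x (N ∸ 2 ℕ.* k)                 ≡⟨ cong (λ n → nat n * pow x (N ∸ 2 ℕ.* k)) c≡0 ⟩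
      0ℚ * pow x (N ∸ 2 ℕ.* k)                    ≡⟨ zeros x (pow x (N ∸ 2 ℕ.* k)) (pow x (suc N ∸ 2 ℕ.* suc k)) ⟩
      x * (0ℚ * pow x (suc N ∸ 2 ℕ.* suc k))      ≡⟨ cong (λ n → x * (nat n * pow x (suc N ∸ 2 ℕ.* suc k))) c≡0 ⟨
      x * (nat c * pow x (suc N ∸ 2 ℕ.* suc k))   ∎
      where
      N≤k+k : N ≤ k ℕ.+ k
      N≤k+k = subst (N ≤_) (cong (k ℕ.+_) (ℕP.+-identityʳ k)) (ℕP.≤-pred (ℕP.≰⇒> 1+2k≰N))
      c≡0 : c ≡ 0
      c≡0 = k>n⇒nCk≡0 (s≤s (ℕP.m≤n+o⇒m∸n≤o N k N≤k+k))
      zeros : ∀ x p q → 0ℚ * p ≡ x * (0ℚ * q)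
      zeros = solve-∀ ℚ-ring

  fibTerm-rec : ∀ N k → fibTerm (2 ℕ.+ N) (suc k) ≡ x * fibTerm (suc N) (suc k) + s * fibTerm N k
  fibTerm-rec N k = begin
    nat ((suc N ∸ k) C suc k) * (s * pow s k * pow x (2 ℕ.+ N ∸ 2 ℕ.* suc k))
      ≡⟨ cong₂ (λ c e → nat c * (s * pow s k * pow x e)) (pascal-∸-diagonal N k) ([2+N]∸2[1+k]≡N∸2k N k) ⟩
    nat (a ℕ.+ b) * (s * pow s k * X)
      ≡⟨ cong (_* (s * pow s k * X)) (nat-homo-+ a b) ⟩
    (nat a + nat b) * (s * pow s k * X)
      ≡⟨ distribute (nat a) (nat b) s (pow s k) X ⟩
    s * fibTerm N k + s * pow s k * (nat b * X)
      ≡⟨ cong (λ y → s * fibTerm N k + s * pow s k * y) (x-shift N k) ⟩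
    s * fibTerm N k + s * pow s k * (x * (nat b * X′))
      ≡⟨ collect (fibTerm N k) s (pow s k) x (nat b) X′ ⟩
    x * fibTerm (suc N) (suc k) + s * fibTerm N k ∎
    where
    a = (N ∸ k) C k
    b = (N ∸ k) C suc k
    X = pow x (N ∸ 2 ℕ.* k)
    X′ = pow x (suc N ∸ 2 ℕ.* suc k)
    distribute : ∀ a b s p X → (a + b) * (s * p * X) ≡ s * (a * (p * X)) + s * p * (b * X)
    distribute = solve-∀ ℚ-ring
    collect : ∀ F s p x b X′ → s * F + s * p * (x * (b * X′)) ≡ x * (b * (s * p * X′)) + s * F
    collect = solve-∀ ℚ-ring

  fibTerm-zero : ∀ N → fibTerm N 0 ≡ pow x N
  fibTerm-zero N = trans (ℚP.*-identityˡ _) (ℚP.*-identityˡ (pow x N))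

  fibPoly-rec : ∀ N → fibPoly (2 ℕ.+ N) ≡ x * fibPoly (suc N) + s * fibPoly N
  fibPoly-rec N = begin
    fibPoly (2 ℕ.+ N)
      ≡⟨ sumTo-suc (suc N) (fibTerm (2 ℕ.+ N)) ⟩
    fibTerm (2 ℕ.+ N) 0 + sumTo (suc N) (λ k → fibTerm (2 ℕ.+ N) (suc k))
      ≡⟨ cong₂ _+_ (fibTerm-zero (2 ℕ.+ N)) (sumTo-cong (suc N) (λ k _ → fibTerm-rec N k)) ⟩
    pow x (2 ℕ.+ N) + sumTo (suc N) (λ k → x * fibTerm (suc N) (suc k) + s * fibTerm N k)
      ≡⟨ cong (pow x (2 ℕ.+ N) +_) (sumTo-distrib-+ (suc N) (λ k → x * fibTerm (suc N) (suc k)) (λ k → s * fibTerm N k)) ⟩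
    pow x (2 ℕ.+ N) + (sumTo (suc N) (λ k → x * fibTerm (suc N) (suc k)) + sumTo (suc N) (λ k → s * fibTerm N k))
      ≡⟨ cong₂ (λ a b → pow x (2 ℕ.+ N) + (a + b)) (sumTo-*ˡ (suc N) x (λ k → fibTerm (suc N) (suc k))) (sumTo-*ˡ (suc N) s (fibTerm N)) ⟩
    pow x (2 ℕ.+ N) + (x * sumTo (suc N) (λ k → fibTerm (suc N) (suc k)) + s * sumTo (suc N) (fibTerm N))
      ≡⟨ cong₂ (λ a b → pow x (2 ℕ.+ N) + (x * a + s * b)) (sumTo-drop-last N _ (fibTerm-beyond (suc N))) (sumTo-drop-last N _ (fibTerm-beyond N)) ⟩
    x * pow x (suc N) + (x * tail + s * fibPoly N)
      ≡⟨ regroup x (pow x (suc N)) tail (s * fibPoly N) ⟩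
    x * (pow x (suc N) + tail) + s * fibPoly N
      ≡⟨ cong (λ y → x * y + s * fibPoly N) (trans (cong (_+ tail) (sym (fibTerm-zero (suc N)))) (sym (sumTo-suc N (fibTerm (suc N))))) ⟩
    x * fibPoly (suc N) + s * fibPoly N ∎
    where
    tail = sumTo N (λ k → fibTerm (suc N) (suc k))
    regroup : ∀ x p t r → x * p + (x * t + r) ≡ x * (p + t) + r
    regroup = solve-∀ ℚ-ring

  lucasTerm : ℕ → ℕ → ℚ
  lucasTerm m i = nat ((m ∸ i) C i) * frac m (m ∸ i) * pow s i * pow x (m ∸ 2 ℕ.* i)

  frac-lucasCoefficient : ∀ M i → frac (2 ℕ.+ M) (suc M ∸ i) * nat ((suc M ∸ i) C suc i)
                                  ≡ nat ((suc M ∸ i) C suc i) + nat ((M ∸ i) C i)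
  frac-lucasCoefficient M i = by-cases (i ℕ.≤? M)
    where
    by-cases : Dec (i ≤ M) → frac (2 ℕ.+ M) (suc M ∸ i) * nat ((suc M ∸ i) C suc i)
                             ≡ nat ((suc M ∸ i) C suc i) + nat ((M ∸ i) C i)
    by-cases (yes i≤M) = subst (λ k → frac (2 ℕ.+ M) k * nat (k C suc i) ≡ nat (k C suc i) + nat (a C i))
                               (sym (ℕP.+-∸-assoc 1 i≤M))
                               (trans (frac-*-nat (2 ℕ.+ M) a c 0 (c ℕ.+ a C i) eq) (trans (ℚP.+-identityʳ _) (nat-homo-+ c (a C i))))
      where
      a = M ∸ i
      c = suc a C suc i
      eq : (2 ℕ.+ M) ℕ.* c ℕ.+ suc a ℕ.* 0 ≡ suc a ℕ.* (c ℕ.+ a C i)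
      eq = begin
        (2 ℕ.+ M) ℕ.* c ℕ.+ suc a ℕ.* 0     ≡⟨ cong₂ (λ n z → (2 ℕ.+ n) ℕ.* c ℕ.+ z) (sym (ℕP.m∸n+n≡m i≤M)) (ℕP.*-zeroʳ (suc a)) ⟩
        (2 ℕ.+ (a ℕ.+ i)) ℕ.* c ℕ.+ 0       ≡⟨ ℕP.+-identityʳ _ ⟩
        (2 ℕ.+ (a ℕ.+ i)) ℕ.* c             ≡⟨ lucasCoefficient a i ⟩
        suc a ℕ.* (c ℕ.+ a C i)             ∎
    -- for i > M the denominator suc M ∸ i is 0, where frac returns 0, and both binomials vanish
    by-cases (no i≰M) = trans (cong (λ k → frac (2 ℕ.+ M) k * nat (k C suc i)) 1+M∸i≡0)
                              (sym (cong₂ (λ k n → nat (k C suc i) + nat n) 1+M∸i≡0 [M∸i]Ci≡0))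
      where
      M<i = ℕP.≰⇒> i≰M
      1+M∸i≡0 : suc M ∸ i ≡ 0
      1+M∸i≡0 = ℕP.m≤n⇒m∸n≡0 M<i
      [M∸i]Ci≡0 : (M ∸ i) C i ≡ 0
      [M∸i]Ci≡0 = k>n⇒nCk≡0 (ℕP.≤-<-trans (ℕP.m∸n≤m M i) M<i)

  lucasTerm-zero : ∀ n → lucasTerm (suc n) 0 ≡ fibTerm (suc n) 0
  lucasTerm-zero n = begin
    1ℚ * frac (suc n) (suc n) * 1ℚ * pow x (suc n)   ≡⟨ cong (λ f → 1ℚ * f * 1ℚ * pow x (suc n)) (frac-self n) ⟩
    1ℚ * 1ℚ * 1ℚ * pow x (suc n)                     ≡⟨ units (pow x (suc n)) ⟩
    pow x (suc n)                                    ≡⟨ fibTerm-zero (suc n) ⟨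
    fibTerm (suc n) 0                                ∎
    where
    units : ∀ p → 1ℚ * 1ℚ * 1ℚ * p ≡ p
    units = solve-∀ ℚ-ring

  lucasTerm-suc : ∀ M i → lucasTerm (2 ℕ.+ M) (suc i) ≡ fibTerm (2 ℕ.+ M) (suc i) + s * fibTerm M i
  lucasTerm-suc M i = begin
    nat c * f * (s * pow s i) * X′                    ≡⟨ rearrange (nat c) f s (pow s i) X′ ⟩
    (f * nat c) * (s * pow s i * X′)                  ≡⟨ cong (_* (s * pow s i * X′)) (frac-lucasCoefficient M i) ⟩
    (nat c + nat c′) * (s * pow s i * X′)             ≡⟨ distribute (nat c) (nat c′) s (pow s i) X′ ⟩
    nat c * (s * pow s i * X′) + s * (nat c′ * (pow s i * X′))
      ≡⟨ cong (λ e → nat c * (s * pow s i * X′) + s * (nat c′ * (pow s i * pow x e))) ([2+N]∸2[1+k]≡N∸2k M i) ⟩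
    fibTerm (2 ℕ.+ M) (suc i) + s * fibTerm M i       ∎
    where
    c = (suc M ∸ i) C suc i
    c′ = (M ∸ i) C i
    f = frac (2 ℕ.+ M) (suc M ∸ i)
    X′ = pow x (2 ℕ.+ M ∸ 2 ℕ.* suc i)
    rearrange : ∀ c f s p X → c * f * (s * p) * X ≡ (f * c) * (s * p * X)
    rearrange = solve-∀ ℚ-ring
    distribute : ∀ c c′ s p X → (c + c′) * (s * p * X) ≡ c * (s * p * X) + s * (c′ * (p * X))
    distribute = solve-∀ ℚ-ring

  lucas-fibPoly : ∀ M → lucas (2 ℕ.+ M) x s ≡ fibPoly (2 ℕ.+ M) + s * fibPoly M
  lucas-fibPoly M = begin
    sumTo (m / 2) (lucasTerm m)
      ≡⟨ sumTo-extend (m / 2) m (lucasTerm m) (m/n≤m m 2) lucasTerm-beyond ⟨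
    sumTo m (lucasTerm m)
      ≡⟨ sumTo-suc (suc M) (lucasTerm m) ⟩
    lucasTerm m 0 + sumTo (suc M) (λ i → lucasTerm m (suc i))
      ≡⟨ cong₂ _+_ (lucasTerm-zero (suc M)) (sumTo-cong (suc M) (λ i _ → lucasTerm-suc M i)) ⟩
    fibTerm m 0 + sumTo (suc M) (λ i → fibTerm m (suc i) + s * fibTerm M i)
      ≡⟨ cong (fibTerm m 0 +_) (sumTo-distrib-+ (suc M) (λ i → fibTerm m (suc i)) (λ i → s * fibTerm M i)) ⟩
    fibTerm m 0 + (sumTo (suc M) (λ i → fibTerm m (suc i)) + sumTo (suc M) (λ i → s * fibTerm M i))
      ≡⟨ cong (λ y → fibTerm m 0 + (sumTo (suc M) (λ i → fibTerm m (suc i)) + y))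
              (trans (sumTo-*ˡ (suc M) s (fibTerm M)) (cong (s *_) (sumTo-drop-last M (fibTerm M) (fibTerm-beyond M)))) ⟩
    fibTerm m 0 + (sumTo (suc M) (λ i → fibTerm m (suc i)) + s * fibPoly M)
      ≡⟨ ℚP.+-assoc (fibTerm m 0) _ (s * fibPoly M) ⟨
    fibTerm m 0 + sumTo (suc M) (λ i → fibTerm m (suc i)) + s * fibPoly M
      ≡⟨ cong (_+ s * fibPoly M) (sumTo-suc (suc M) (fibTerm m)) ⟨
    fibPoly m + s * fibPoly M ∎
    where
    m = 2 ℕ.+ M
    lucasTerm-beyond : ∀ i → m / 2 < i → lucasTerm m i ≡ 0ℚ
    lucasTerm-beyond i m/2<i = trans (cong (λ n → nat n * frac m (m ∸ i) * pow s i * pow x (m ∸ 2 ℕ.* i)) (m/2<i⇒[m∸i]Ci≡0 m i m/2<i))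
                                     (zeros (frac m (m ∸ i)) (pow s i) (pow x (m ∸ 2 ℕ.* i)))
      where
      zeros : ∀ f p q → 0ℚ * f * p * q ≡ 0ℚ
      zeros = solve-∀ ℚ-ring

lucas-one : ∀ x s → lucas 1 x s ≡ x
lucas-one x s = units x
  where
  units : ∀ x → 1ℚ * 1ℚ * 1ℚ * (x * 1ℚ) ≡ x
  units = solve-∀ ℚ-ring

recurrence₂-unique : ∀ x s (f g : ℕ → ℚ) →
  (∀ n → f (2 ℕ.+ n) ≡ x * f (suc n) + s * f n) →
  (∀ n → g (2 ℕ.+ n) ≡ x * g (suc n) + s * g n) →
  f 0 ≡ g 0 → f 1 ≡ g 1 → ∀ n → f n ≡ g n
recurrence₂-unique x s f g f-rec g-rec f0≡g0 f1≡g1 = f≗g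
  where
  f≗g : ∀ n → f n ≡ g n
  f≗g zero          = f0≡g0
  f≗g (suc zero)    = f1≡g1
  f≗g (suc (suc n)) = trans (f-rec n) (trans (cong₂ (λ a b → x * a + s * b) (f≗g (suc n)) (f≗g n)) (sym (g-rec n)))

crossPoly≡fibPoly : ∀ u v N → Bivariate.crossPoly u v N ≡ Fibonacci.fibPoly (1ℚ + u + v) (- (u * v)) N
crossPoly≡fibPoly u v = recurrence₂-unique (1ℚ + u + v) (- (u * v)) _ _
  (Bivariate.crossPoly-rec u v) (Fibonacci.fibPoly-rec (1ℚ + u + v) (- (u * v))) refl (degree-one u v)
  where
  degree-one : ∀ u v → 1ℚ * (1ℚ * 1ℚ) + 1ℚ * (1ℚ * (v * 1ℚ)) + (1ℚ * (u * 1ℚ * 1ℚ) + 0ℚ * (u * 1ℚ * (v * 1ℚ)))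
                       ≡ 1ℚ * (1ℚ * ((1ℚ + u + v) * 1ℚ)) + 0ℚ * (- (u * v) * 1ℚ * 1ℚ)
  degree-one = solve-∀ ℚ-ring

≡ᵇ-refl : ∀ n → (n ≡ᵇ n) ≡ true
≡ᵇ-refl zero    = refl
≡ᵇ-refl (suc n) = ≡ᵇ-refl n

<⇒≡ᵇ-false : ∀ {d m} → d < m → (d ≡ᵇ m) ≡ false
<⇒≡ᵇ-false {zero}  {suc m} _         = refl
<⇒≡ᵇ-false {suc d} {suc m} (s≤s d<m) = <⇒≡ᵇ-false d<m

rho-diagonal : ∀ m t → rho m t m ≡ 1ℚ + pow t m
rho-diagonal m t = if-cong (≡ᵇ-refl m)

rho-below : ∀ m t d → d < m → rho m t d ≡ frac m (m ∸ d) * sumTo d (λ i → nat (rhoCoefficient m d i) * pow t i)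
rho-below m t d d<m = if-cong (<⇒≡ᵇ-false d<m)

module Beta (t q : ℚ) where
  open ≡-Reasoning

  u v : ℚ
  u = t * - q
  v = - q

  open Bivariate u v public

  betaTerm : ℕ → ℕ → ℕ → ℚ
  betaTerm M i j = (nat (cross (2 ℕ.+ M) i j) - nat (shiftˡ (shiftʳ (cross M)) i j)) * monomial i j

  betaTerm-outside : ∀ M i j → 2 ℕ.+ M < i ℕ.+ j → betaTerm M i j ≡ 0ℚ
  betaTerm-outside M i j lt = trans (cong₂ (λ a b → (nat a - nat b) * monomial i j) (cross-outside (2 ℕ.+ M) i j lt) (shift²-cross-outside M i j lt))
                                    (ℚP.*-zeroˡ (monomial i j))

  monomial-split : ∀ i d → i ≤ d → pow t i * pow v d ≡ monomial i (d ∸ i)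
  monomial-split i d i≤d = begin
    pow t i * pow v d                         ≡⟨ cong (λ e → pow t i * pow v e) (ℕP.m+[n∸m]≡n i≤d) ⟨
    pow t i * pow v (i ℕ.+ (d ∸ i))           ≡⟨ cong (pow t i *_) (pow-+ v i (d ∸ i)) ⟩
    pow t i * (pow v i * pow v (d ∸ i))       ≡⟨ ℚP.*-assoc (pow t i) (pow v i) (pow v (d ∸ i)) ⟨
    pow t i * pow v i * pow v (d ∸ i)         ≡⟨ cong (_* pow v (d ∸ i)) (pow-distrib-* t v i) ⟨
    monomial i (d ∸ i)                        ∎

  rhoTerm-below : ∀ M d → d < 2 ℕ.+ M → rho (2 ℕ.+ M) t d * pow v d ≡ sumTo d (λ i → betaTerm M i (d ∸ i))
  rhoTerm-below M d d<m = begin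
    rho m t d * pow v d
      ≡⟨ cong (_* pow v d) (rho-below m t d d<m) ⟩
    frac m (m ∸ d) * sumTo d g * pow v d
      ≡⟨ cong (λ k → frac m k * sumTo d g * pow v d) (ℕP.+-∸-assoc 1 d≤1+M) ⟩
    f * sumTo d g * pow v d
      ≡⟨ cong (_* pow v d) (sumTo-*ˡ d f g) ⟨
    sumTo d (λ i → f * g i) * pow v d
      ≡⟨ sumTo-*ʳ d (pow v d) (λ i → f * g i) ⟩
    sumTo d (λ i → f * g i * pow v d)
      ≡⟨ sumTo-cong d term ⟩
    sumTo d (λ i → betaTerm M i (d ∸ i)) ∎
    where
    m = 2 ℕ.+ M
    d≤1+M = ℕP.≤-pred d<m
    f = frac m (suc (suc M ∸ d))
    g : ℕ → ℚ
    g i = nat (rhoCoefficient m d i) * pow t i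
    regroup : ∀ f c a b → f * (c * a) * b ≡ (f * c) * (a * b)
    regroup = solve-∀ ℚ-ring
    term : ∀ i → i ≤ d → f * g i * pow v d ≡ betaTerm M i (d ∸ i)
    term i i≤d = trans (regroup f (nat (rhoCoefficient m d i)) (pow t i) (pow v d))
      (cong₂ _*_ (frac-*-nat m (suc M ∸ d) (rhoCoefficient m d i) _ _ (rhoCoefficient-cross M d i d≤1+M i≤d))
                 (monomial-split i d i≤d))

  rhoTerm-diagonal : ∀ M → rho (2 ℕ.+ M) t (2 ℕ.+ M) * pow v (2 ℕ.+ M) ≡ sumTo (2 ℕ.+ M) (λ i → betaTerm M i (2 ℕ.+ M ∸ i))
  rhoTerm-diagonal M = sym (begin
    sumTo m g
      ≡⟨ sumTo-suc (suc M) g ⟩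
    g 0 + (sumTo M (λ i → g (suc i)) + g m)
      ≡⟨ cong (λ z → g 0 + (z + g m)) (sumTo-zero M (λ i → g (suc i)) interior) ⟩
    g 0 + (0ℚ + g m)
      ≡⟨ cong₂ (λ a b → (nat a - 0ℚ) * (1ℚ * pow v m) + (0ℚ + b)) (cross-antidiagonal m 0 z≤n) last ⟩
    (1ℚ - 0ℚ) * (1ℚ * pow v m) + (0ℚ + (1ℚ - 0ℚ) * (pow u m * 1ℚ))
      ≡⟨ cong (λ p → (1ℚ - 0ℚ) * (1ℚ * pow v m) + (0ℚ + (1ℚ - 0ℚ) * (p * 1ℚ))) (pow-distrib-* t v m) ⟩
    (1ℚ - 0ℚ) * (1ℚ * pow v m) + (0ℚ + (1ℚ - 0ℚ) * (pow t m * pow v m * 1ℚ))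
      ≡⟨ collect (pow t m) (pow v m) ⟩
    (1ℚ + pow t m) * pow v m
      ≡⟨ cong (_* pow v m) (rho-diagonal m t) ⟨
    rho m t m * pow v m ∎)
    where
    m = 2 ℕ.+ M
    g : ℕ → ℚ
    g i = betaTerm M i (m ∸ i)
    cancel : ∀ w → (1ℚ - 1ℚ) * w ≡ 0ℚ
    cancel = solve-∀ ℚ-ring
    interior : ∀ i → i ≤ M → g (suc i) ≡ 0ℚ
    interior i i≤M = trans (cong₂ (λ a b → (nat a - nat b) * monomial (suc i) (m ∸ suc i))
                                  (cross-antidiagonal m (suc i) (s≤s (ℕP.m≤n⇒m≤1+n i≤M))) (shift²-cross-antidiagonal M i i≤M))
                           (cancel (monomial (suc i) (m ∸ suc i)))
    last : g m ≡ (1ℚ - 0ℚ) * (pow u m * 1ℚ)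
    last = trans (cong (betaTerm M m) (ℕP.n∸n≡0 m)) (cong (λ c → (nat c - 0ℚ) * (pow u m * 1ℚ)) (cong (ℕ._* 1) (nCn≡1 m)))
    collect : ∀ T V → (1ℚ - 0ℚ) * (1ℚ * V) + (0ℚ + (1ℚ - 0ℚ) * (T * V * 1ℚ)) ≡ (1ℚ + T) * V
    collect = solve-∀ ℚ-ring

  beta≡crossPoly : ∀ M → beta (2 ℕ.+ M) t q ≡ crossPoly (2 ℕ.+ M) + - (u * v) * crossPoly M
  beta≡crossPoly M = begin
    sumTo m (λ d → rho m t d * pow v d)
      ≡⟨ cong₂ _+_ (sumTo-cong (suc M) (λ d d≤1+M → rhoTerm-below M d (s≤s d≤1+M))) (rhoTerm-diagonal M) ⟩
    sumTo m (λ d → sumTo d (λ i → betaTerm M i (d ∸ i)))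
      ≡⟨ sumTo-antidiagonals m (betaTerm M) (betaTerm-outside M) ⟩
    sumRect m m (betaTerm M)
      ≡⟨ sumRect-cong m m (λ i j → split (nat (cross m i j)) (nat (shifted i j)) (monomial i j)) ⟩
    sumRect m m (λ i j → nat (cross m i j) * monomial i j + - (nat (shifted i j) * monomial i j))
      ≡⟨ sumRect-distrib-+ m m _ (λ i j → - (nat (shifted i j) * monomial i j)) ⟩
    crossPoly m + sumRect m m (λ i j → - (nat (shifted i j) * monomial i j))
      ≡⟨ cong (crossPoly m +_) (sumRect-neg m m (λ i j → nat (shifted i j) * monomial i j)) ⟩
    crossPoly m + - poly m m shifted
      ≡⟨ cong (λ p → crossPoly m + - p) (poly-shift²-cross M) ⟩
    crossPoly m + - (u * (v * crossPoly M))
      ≡⟨ reassociate u v (crossPoly m) (crossPoly M) ⟩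
    crossPoly m + - (u * v) * crossPoly M ∎
    where
    m = 2 ℕ.+ M
    shifted = shiftˡ (shiftʳ (cross M))
    split : ∀ a b w → (a - b) * w ≡ a * w + - (b * w)
    split = solve-∀ ℚ-ring
    reassociate : ∀ u v a b → a + - (u * (v * b)) ≡ a + - (u * v) * b
    reassociate = solve-∀ ℚ-ring

beta-one : ∀ t q → beta 1 t q ≡ 1ℚ - q - t * q
beta-one t q = trans (cong (λ r → r * 1ℚ + (1ℚ + pow t 1) * (- q * 1ℚ)) (rho-below 1 t 0 (s≤s z≤n))) (expand t q)
  where
  expand : ∀ t q → 1ℚ * (1ℚ * 1ℚ) * 1ℚ + (1ℚ + t * 1ℚ) * (- q * 1ℚ) ≡ 1ℚ - q - t * q
  expand = solve-∀ ℚ-ring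

lemma2p2 : (m : ℕ) → m ≥ 1 → (t q : ℚ) →
    beta m t q ≡ lucas m (1ℚ - q - t * q) (- (t * q * q))
lemma2p2 (suc zero)    _ t q = trans (beta-one t q) (sym (lucas-one (1ℚ - q - t * q) (- (t * q * q))))
lemma2p2 (suc (suc M)) _ t q = begin
  beta m t q                      ≡⟨ beta≡crossPoly M ⟩
  crossPoly m + s * crossPoly M   ≡⟨ cong₂ (λ a b → a + s * b) (crossPoly≡fibPoly u v m) (crossPoly≡fibPoly u v M) ⟩
  fibPoly m + s * fibPoly M       ≡⟨ lucas-fibPoly M ⟨
  lucas m x s                     ≡⟨ cong₂ (lucas m) (x≡ t q) (s≡ t q) ⟩
  lucas m (1ℚ - q - t * q) (- (t * q * q)) ∎
  where
  open ≡-Reasoning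
  open Beta t q
  m = 2 ℕ.+ M
  x = 1ℚ + u + v
  s = - (u * v)
  open Fibonacci x s
  x≡ : ∀ t q → 1ℚ + t * - q + - q ≡ 1ℚ - q - t * q
  x≡ = solve-∀ ℚ-ring
  s≡ : ∀ t q → - (t * - q * - q) ≡ - (t * q * q)
  s≡ = solve-∀ ℚ-ring
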